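{- Let $n\ge 2$ and let $D$ be the orientation of the line graph $L(\mu(C_{2n+1}))$ described in the context. Then $D$ contains no shortcut.
   Context: A directed graph on vertex set $\{a_1,\dots,a_k\}$, $k\ge 4$, is a shortcut if it contains a directed path $\langle a_1,a_2,\dots,a_k\rangle$ and the edge $a_1\to a_k$ (the shortcutting edge), but there exist $1\le i<j\le k$ such that there is no edge $a_i\to a_j$; an oriented graph contains a shortcut if some induced subgraph is a shortcut. For a graph $G$ with vertex set $[m]=\{1,\dots,m\}$ and edge set $E(G)$, the Mycielski graph $\mu(G)$ has vertex set $[m]\cup\{1',\dots,m'\}\cup\{0\}$ and edge set $E(G)\cup\{\overline{0i'} : i\in[m]\}\cup\{\overline{ji'},\overline{ij'} : \overline{ij}\in E(G)\}$. Here $C_{2n+1}$ is the cycle on $[2n+1]$ with edges $\overline{i(i+1)}$ for $1\le i\le 2n$ and $\overline{1(2n+1)}$. The line graph $L(G)$ has the edges of $G$ as vertices, two being adjacent iff they share an endpoint. Label the vertices of $L(\mu(C_{2n+1}))$ as follows: for an edge $\overline{ij}$ of $C_{2n+1}$ with $i<j$, write $c_{ij}$; for an edge of $\mu(C_{2n+1})$ joining $i\in\{0,1,\dots,2n+1\}$ and $j'$ ($1\le j\le 2n+1$), write $a_{ij'}$. The orientation $D$ of $L(\mu(C_{2n+1}))$ is: (I) for any two vertices $a_{ij_1'},a_{ij_2'}$ (same $i$) with $j_1<j_2$, orient $a_{ij_1'}\to a_{ij_2'}$; for any two vertices $a_{i_1j'},a_{i_2j'}$ (same $j$) with $i_1>i_2$,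 orient $a_{i_1j'}\to a_{i_2j'}$; (II) for $1\le i\le 2n-1$, orient $c_{(i+1)(i+2)}\to c_{i(i+1)}$, and orient $c_{1(2n+1)}\to c_{12}$ and $c_{(2n)(2n+1)}\to c_{1(2n+1)}$; (III) every edge between a vertex $a_{ij'}$ and a vertex $c_{kl}$ is oriented from $a_{ij'}$ to $c_{kl}$. -}

module Defs where

open import Data.Nat using (ℕ; zero; suc; _+_; _*_; _∸_; _≤_; _<_; _>_)
open import Data.Fin using (Fin; toℕ; inject₁; fromℕ)
open import Data.Product using (_×_; Σ; ∃; _,_)
open import Data.Sum using (_⊎_)
open import Relation.Binary.PropositionalEquality using (_≡_; _≢_)
open import Relation.Nullary using (¬_)
open import Function.Definitions using (Injective)

-- Number of vertices of the odd cycle C_{2n+1}; its vertices are 1,…,2n+1.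
cyc : ℕ → ℕ
cyc n = 2 * n + 1

data CycEdge (n : ℕ) : ℕ → ℕ → Set where
  step : ∀ {i} → 1 ≤ i → i ≤ 2 * n → CycEdge n i (suc i)
  wrap : CycEdge n 1 (cyc n)

CycAdj : ℕ → ℕ → ℕ → Set
CycAdj n i j = CycEdge n i j ⊎ CycEdge n j i

-- Vertices of L(μ(C_{2n+1})), i.e. edges of μ(C_{2n+1}):
--   c i j  = c_{ij}  : the cycle edge ij (i < j)
--   a i j  = a_{ij'} : the edge joining i ∈ {0,1,…,2n+1} and j'
data Vtx : Set where
  c : ℕ → ℕ → Vtx
  a : ℕ → ℕ → Vtx

data IsVertex (n : ℕ) : Vtx → Set where
  c-vert  : ∀ {i j} → CycEdge n i j → IsVertex n (c i j)
  a0-vert : ∀ {j} → 1 ≤ j → j ≤ cyc n → IsVertex n (a 0 j)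
  a-vert  : ∀ {i j} → CycAdj n i j → IsVertex n (a i j)

data End : Set where
  orig  : ℕ → End
  prime : ℕ → End

data EndOf : Vtx → End → Set where
  c-l : ∀ {i j} → EndOf (c i j) (orig i)
  c-r : ∀ {i j} → EndOf (c i j) (orig j)
  a-l : ∀ {i j} → EndOf (a i j) (orig i)
  a-r : ∀ {i j} → EndOf (a i j) (prime j)

LAdj : Vtx → Vtx → Set
LAdj u v = u ≢ v × ∃ λ e → EndOf u e × EndOf v e

data Rule (n : ℕ) : Vtx → Vtx → Set where
  sameI : ∀ {i j₁ j₂} → j₁ < j₂ → Rule n (a i j₁) (a i j₂)
  sameJ : ∀ {i₁ i₂ j} → i₁ > i₂ → Rule n (a i₁ j) (a i₂ j)
  cc    : ∀ {i} → 1 ≤ i → i ≤ 2 * n ∸ 1 →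
          Rule n (c (suc i) (suc (suc i))) (c i (suc i))
  cwrap₁ : Rule n (c 1 (cyc n)) (c 1 2)
  cwrap₂ : Rule n (c (2 * n) (cyc n)) (c 1 (cyc n))
  ac    : ∀ {i j k l} → Rule n (a i j) (c k l)

Arc : ℕ → Vtx → Vtx → Set
Arc n u v = LAdj u v × Rule n u v

record Shortcut (n : ℕ) : Set where
  field
    r      : ℕ
    r≥3    : 3 ≤ r
    v      : Fin (suc r) → Vtx
    vert   : ∀ i → IsVertex n (v i)
    inj    : Injective _≡_ _≡_ v
    path   : ∀ (i : Fin r) → Arc n (v (inject₁ i)) (v (Fin.suc i))
    short  : Arc n (v Fin.zero) (v (fromℕ r))
    i j    : Fin (suc r)
    i<j    : toℕ i < toℕ j
    noEdge : ¬ Arc n (v i) (v j)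

ContainsShortcut : ℕ → Set
ContainsShortcut n = Shortcut n

{-# OPTIONS --safe #-}
-- D is acyclic: `rank` strictly decreases along its arcs. The vertices of L(μ(C_{2n+1}))
-- containing a fixed endpoint e form a clique on which D is total, hence transitive. A directed
-- path that leaves this clique never returns to it, because every arc out of the clique enters
-- the set `Beyond n e`, which is closed under arcs and avoids the clique. The two ends of a
-- shortcut's path are joined by the shortcutting edge, so they share an endpoint e; the whole
-- path then lies in the clique of e, where every forward pair is an arc.
module Submission where

open import Defs
open import Data.Nat using (ℕ; suc; _+_; _*_; _∸_; _≤_; _<_; _≤?_; z≤n; s≤s)
open import Data.Nat.Properties
open import Data.Fin as Fin using (Fin; inject₁; fromℕ)
open import Data.Fin.Induction using (<-weakInduction; <-weakInduction-startingFrom)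
open import Data.Fin.Properties using (≤fromℕ)
open import Data.Product using (_×_; _,_; proj₁; proj₂)
open import Data.Sum using (_⊎_; inj₁; inj₂; [_,_]; swap)
open import Function using (_∘_; id)
open import Relation.Binary.Construct.Closure.ReflexiveTransitive using (Star; ε; _◅_; _◅◅_; fold)
open import Relation.Binary.Definitions using (tri<; tri≈; tri>)
open import Relation.Binary.PropositionalEquality using (_≡_; _≢_; refl; sym; trans; cong; subst)
open import Relation.Nullary using (¬_; contradiction)
open import Relation.Nullary.Decidable using (True; toWitness)

private
  variable
    A : Set
    i i₁ i₂ j j₁ j₂ p p′ q q′ r x : ℕ
    e : End
    u w : Vtx

module _ {_⟶_ : A → A → Set} where

  Star-preserves : {P : A → Set} → (∀ {x y} → x ⟶ y → P x → P y) →
                   ∀ {x y} → Star _⟶_ x y → P x → P y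
  Star-preserves preserves = fold _ (λ x⟶y Py⇒Pz → Py⇒Pz ∘ preserves x⟶y) id

  Star-descends : (f : A → ℕ) → (∀ {x y} → x ⟶ y → f y < f x) →
                  ∀ {x y} → Star _⟶_ x y → x ≢ y → f y < f x
  Star-descends f descends ε x≢x = contradiction refl x≢x
  Star-descends f descends (x⟶z ◅ z⟶⋆y) _ = ≤-<-trans (non-increasing z⟶⋆y) (descends x⟶z)
    where
    non-increasing : ∀ {x y} → Star _⟶_ x y → f y ≤ f x
    non-increasing = fold (λ x y → f y ≤ f x)
                          (λ x⟶y fz≤fy → ≤-trans fz≤fy (<⇒≤ (descends x⟶y))) ≤-refl

module _ (_⟶_ : A → A → Set) {r : ℕ} (v : Fin (suc r) → A)
         (step : ∀ k → v (inject₁ k) ⟶ v (Fin.suc k)) where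

  walk : ∀ {k l} → k Fin.≤ l → Star _⟶_ (v k) (v l)
  walk {k} = <-weakInduction-startingFrom (Star _⟶_ (v k) ∘ v) ε (λ l w → w ◅◅ (step l ◅ ε))

  walk-stays : {K B : A → Set} →
               (∀ {x y} → x ⟶ y → K x → K y ⊎ B y) →
               (∀ {x y} → x ⟶ y → B x → B y) →
               (∀ {x} → B x → ¬ K x) →
               K (v Fin.zero) → K (v (fromℕ r)) → ∀ k → K (v k)
  walk-stays {K} {B} exit closed disjoint K₀ Kᵣ k
    with <-weakInduction (λ k → K (v k) ⊎ B (v k)) (inj₁ K₀)
                         (λ l → [ exit (step l) , inj₂ ∘ closed (step l) ]) k
  ... | inj₁ Kₖ = Kₖ
  ... | inj₂ Bₖ = contradiction Kᵣ (disjoint (Star-preserves closed (walk (≤fromℕ k)) Bₖ))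

cyc≡1+2n : ∀ n → cyc n ≡ suc (2 * n)
cyc≡1+2n n = +-comm (2 * n) 1

≤2n⇒<cyc : ∀ {k} n → k ≤ 2 * n → k < cyc n
≤2n⇒<cyc n k≤2n = ≤-trans (s≤s k≤2n) (≤-reflexive (sym (cyc≡1+2n n)))

<cyc⇒≤2n : ∀ {k} n → k < cyc n → k ≤ 2 * n
<cyc⇒≤2n n k<cyc = ≤-pred (≤-trans k<cyc (≤-reflexive (cyc≡1+2n n)))

cyc≰2n : ∀ n → ¬ cyc n ≤ 2 * n
cyc≰2n n = <⇒≱ (≤2n⇒<cyc n ≤-refl)

-- CycEdge with its indices turned into equations: `cyc n` is not in constructor form, so
-- matching `wrap` against an index that is already fixed would get stuck.
data EdgeView (n p q : ℕ) : Set where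
  next   : 1 ≤ p → p ≤ 2 * n → q ≡ suc p → EdgeView n p q
  around : p ≡ 1 → q ≡ cyc n → EdgeView n p q

Adjacent : ℕ → ℕ → ℕ → Set
Adjacent n i j = EdgeView n i j ⊎ EdgeView n j i

data AView (n i j : ℕ) : Set where
  apex : i ≡ 0 → 1 ≤ j → j ≤ cyc n → AView n i j
  rim  : Adjacent n i j → AView n i j

edge-view : ∀ {n} → CycEdge n p q → EdgeView n p q
edge-view (step 1≤p p≤2n) = next 1≤p p≤2n refl
edge-view wrap = around refl refl

c-view : ∀ {n} → IsVertex n (c p q) → EdgeView n p q
c-view (c-vert e) = edge-view e

a-view : ∀ {n} → IsVertex n (a i j) → AView n i j
a-view (a0-vert 1≤j j≤cyc) = apex refl 1≤j j≤cyc
a-view (a-vert (inj₁ e)) = rim (inj₁ (edge-view e))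
a-view (a-vert (inj₂ e)) = rim (inj₂ (edge-view e))

-- Every a-vertex outranks every c-vertex; on vertices j ≤ cyc n, so `cyc n ∸ j` never truncates.
rank : ℕ → Vtx → ℕ
rank n (c p q) = p + q
rank n (a i j) = 2 * cyc n + i + (cyc n ∸ j)

-- Vertices from which no directed path of D reaches an edge at e; the `last-…` cases are
-- the irregular ones for e = 2n+1, the end of the wrap-around edge.
data Beyond (n : ℕ) : End → Vtx → Set where
  prime-c : Beyond n (prime j) (c p q)
  prime-a : j < j₁ → Beyond n (prime j) (a i j₁)
  apex-a  : 1 ≤ i → Beyond n (orig i) (a 0 j)
  lower-a : 1 ≤ r → 2 + r ≤ i → i ≤ 2 * n → Beyond n (orig i) (a r j)
  lower-c : p < i → q < i → Beyond n (orig i) (c p q)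
  wrap-c  : p ≡ 1 → q ≡ cyc n → 3 ≤ i → i ≤ 2 * n → Beyond n (orig i) (c p q)
  last-up : i ≡ cyc n → 2 ≤ r → r < 2 * n → Beyond n (orig i) (a r (suc r))
  last-21 : i ≡ cyc n → Beyond n (orig i) (a 2 1)

module _ {n : ℕ} (2≤n : 2 ≤ n) where

  4≤2n : 4 ≤ 2 * n
  4≤2n = *-monoʳ-≤ 2 2≤n

  ≤2n : ∀ k {k≤4 : True (k ≤? 4)} → k ≤ 2 * n
  ≤2n k {k≤4} = ≤-trans (toWitness k≤4) 4≤2n

  ≤cyc : ∀ k {k≤5 : True (k ≤? 5)} → k ≤ cyc n
  ≤cyc k {k≤5} = ≤-trans (toWitness k≤5) (≤2n⇒<cyc n 4≤2n)

  cyc≢ : ∀ k {k≤4 : True (k ≤? 4)} → cyc n ≢ k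
  cyc≢ k {k≤4} refl = ≤⇒≯ (toWitness k≤4) (≤cyc 5)

  edge-bounds : EdgeView n p q → 1 ≤ p × p < q × q ≤ cyc n
  edge-bounds (next 1≤p p≤2n refl) = 1≤p , ≤-refl , ≤2n⇒<cyc n p≤2n
  edge-bounds (around refl refl) = ≤-refl , ≤cyc 2 , ≤-refl

  edge-< : EdgeView n p q → p < q
  edge-< = proj₁ ∘ proj₂ ∘ edge-bounds

  adjacent-bounds : Adjacent n i j → 1 ≤ i × i ≤ cyc n
  adjacent-bounds (inj₁ e) with edge-bounds e
  ... | 1≤i , i<j , j≤cyc = 1≤i , ≤-trans (<⇒≤ i<j) j≤cyc
  adjacent-bounds (inj₂ e) with edge-bounds e
  ... | 1≤j , j<i , i≤cyc = ≤-trans 1≤j (<⇒≤ j<i) , i≤cyc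

  a-≤cyc : AView n i j → j ≤ cyc n
  a-≤cyc (apex _ _ j≤cyc) = j≤cyc
  a-≤cyc (rim adj) = proj₂ (adjacent-bounds (swap adj))

  edge-irrefl : ¬ EdgeView n i i
  edge-irrefl (next _ _ i≡1+i) = 1+n≢n (sym i≡1+i)
  edge-irrefl (around refl 1≡cyc) = cyc≢ 1 (sym 1≡cyc)

  no-triangle : Adjacent n r j → ¬ Adjacent n (suc r) j
  no-triangle (inj₁ (next _ _ refl)) (inj₁ e) = edge-irrefl e
  no-triangle (inj₁ (next _ _ refl)) (inj₂ e) = edge-irrefl e
  no-triangle (inj₁ (around refl refl)) (inj₁ (next _ _ cyc≡3)) = cyc≢ 3 cyc≡3
  no-triangle (inj₁ (around refl refl)) (inj₂ (next _ cyc≤2n _)) = cyc≰2n n cyc≤2n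
  no-triangle (inj₁ (around refl refl)) (inj₂ (around cyc≡1 _)) = cyc≢ 1 cyc≡1
  no-triangle (inj₂ (next _ _ refl)) (inj₁ (next _ _ ()))
  no-triangle (inj₂ (next _ _ refl)) (inj₂ (next _ _ ()))
  no-triangle (inj₂ (next _ _ refl)) (inj₂ (around refl cyc≡3)) = cyc≢ 3 (sym cyc≡3)
  no-triangle (inj₂ (around refl refl)) (inj₁ (next _ _ ()))
  no-triangle (inj₂ (around refl refl)) (inj₁ (around 1+cyc≡1 _)) = cyc≢ 0 (suc-injective 1+cyc≡1)
  no-triangle (inj₂ (around refl refl)) (inj₂ (next _ _ 1+cyc≡2)) = cyc≢ 1 (suc-injective 1+cyc≡2)
  no-triangle (inj₂ (around refl refl)) (inj₂ (around _ 1+cyc≡cyc)) = 1+n≢n 1+cyc≡cyc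

  rank-decreasing : IsVertex n w → Rule n u w → rank n w < rank n u
  rank-decreasing iw (sameI {i} j₁<j₂) =
    +-monoʳ-< (2 * cyc n + i) (∸-monoʳ-< j₁<j₂ (a-≤cyc (a-view iw)))
  rank-decreasing _ (sameJ {j = j} i₁>i₂) = +-monoˡ-< (cyc n ∸ j) (+-monoʳ-< (2 * cyc n) i₁>i₂)
  rank-decreasing _ (cc {i} _ _) = +-mono-< (n<1+n i) (n<1+n (suc i))
  rank-decreasing _ cwrap₁ = s≤s (≤cyc 3)
  rank-decreasing _ cwrap₂ = +-monoˡ-< (cyc n) (≤2n 2)
  rank-decreasing iw (ac {i} {j} {k} {l}) with edge-bounds (c-view iw)
  ... | _ , k<l , l≤cyc = begin-strict
    k + l              <⟨ +-mono-<-≤ (<-≤-trans k<l l≤cyc) l≤cyc ⟩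
    cyc n + cyc n      ≡⟨ cong (cyc n +_) (sym (+-identityʳ (cyc n))) ⟩
    2 * cyc n          ≤⟨ m≤m+n _ i ⟩
    2 * cyc n + i      ≤⟨ m≤m+n _ (cyc n ∸ j) ⟩
    rank n (a i j)     ∎
    where open ≤-Reasoning

  wrap-rule : suc p ≡ cyc n → Rule n (c p (suc p)) (c 1 (suc p))
  wrap-rule 1+p≡cyc with suc-injective (trans 1+p≡cyc (cyc≡1+2n n))
  ... | refl = subst (λ m → Rule n (c (2 * n) m) (c 1 m)) (cyc≡1+2n n) cwrap₂

  consecutive-rule : EdgeView n p q → EdgeView n p′ p → Rule n (c p q) (c p′ p)
  consecutive-rule (next _ p≤2n refl) (next 1≤p′ _ refl) = cc 1≤p′ (∸-monoˡ-≤ 1 p≤2n)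
  consecutive-rule (next _ p≤2n _) (around _ p≡cyc) =
    contradiction (subst (_≤ 2 * n) p≡cyc p≤2n) (cyc≰2n n)
  consecutive-rule (around refl _) (next () _ refl)
  consecutive-rule (around refl _) (around _ 1≡cyc) = contradiction (sym 1≡cyc) (cyc≢ 1)

  same-left-rule : EdgeView n p q → EdgeView n p q′ → c p q ≢ c p q′ →
                   Rule n (c p q) (c p q′) ⊎ Rule n (c p q′) (c p q)
  same-left-rule (next _ _ refl) (next _ _ refl) c≢c′ = contradiction refl c≢c′
  same-left-rule (next _ _ refl) (around refl refl) _ = inj₂ cwrap₁
  same-left-rule (around refl refl) (next _ _ refl) _ = inj₁ cwrap₁
  same-left-rule (around refl refl) (around _ refl) c≢c′ = contradiction refl c≢c′

  same-right-rule : EdgeView n p q → EdgeView n p′ q → c p q ≢ c p′ q →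
                    Rule n (c p q) (c p′ q) ⊎ Rule n (c p′ q) (c p q)
  same-right-rule (next _ _ refl) (next _ _ refl) c≢c′ = contradiction refl c≢c′
  same-right-rule (next _ _ refl) (around refl 1+p≡cyc) _ = inj₁ (wrap-rule 1+p≡cyc)
  same-right-rule (around refl 1+p≡cyc) (next _ _ refl) _ = inj₂ (wrap-rule 1+p≡cyc)
  same-right-rule (around refl _) (around refl _) c≢c′ = contradiction refl c≢c′

  cycle-rule-total : EdgeView n p q → EdgeView n p′ q′ → c p q ≢ c p′ q′ →
                     EndOf (c p q) e → EndOf (c p′ q′) e →
                     Rule n (c p q) (c p′ q′) ⊎ Rule n (c p′ q′) (c p q)
  cycle-rule-total e₁ e₂ c≢c′ c-l c-l = same-left-rule e₁ e₂ c≢c′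
  cycle-rule-total e₁ e₂ _ c-l c-r = inj₁ (consecutive-rule e₁ e₂)
  cycle-rule-total e₁ e₂ _ c-r c-l = inj₂ (consecutive-rule e₂ e₁)
  cycle-rule-total e₁ e₂ c≢c′ c-r c-r = same-right-rule e₁ e₂ c≢c′

  rule-total : IsVertex n u → IsVertex n w → u ≢ w → EndOf u e → EndOf w e →
               Rule n u w ⊎ Rule n w u
  rule-total _ _ u≢w (a-l {j = j₁}) (a-l {j = j₂}) with <-cmp j₁ j₂
  ... | tri< j₁<j₂ _ _ = inj₁ (sameI j₁<j₂)
  ... | tri≈ _ refl _ = contradiction refl u≢w
  ... | tri> _ _ j₁>j₂ = inj₂ (sameI j₁>j₂)
  rule-total _ _ u≢w (a-r {i = i₁}) (a-r {i = i₂}) with <-cmp i₁ i₂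
  ... | tri< i₁<i₂ _ _ = inj₂ (sameJ i₁<i₂)
  ... | tri≈ _ refl _ = contradiction refl u≢w
  ... | tri> _ _ i₁>i₂ = inj₁ (sameJ i₁>i₂)
  rule-total _ _ _ a-l c-l = inj₁ ac
  rule-total _ _ _ a-l c-r = inj₁ ac
  rule-total _ _ _ c-l a-l = inj₂ ac
  rule-total _ _ _ c-r a-l = inj₂ ac
  rule-total (c-vert e₁) (c-vert e₂) u≢w s₁ s₂ =
    cycle-rule-total (edge-view e₁) (edge-view e₂) u≢w s₁ s₂

  edge-below : p < q → q < x → Beyond n (orig x) (c p q)
  edge-below p<q q<x = lower-c (<-trans p<q q<x) q<x

  beyond-excludes : Beyond n e w → ¬ EndOf w e
  beyond-excludes prime-c ()
  beyond-excludes (prime-a j<j) a-r = <-irrefl refl j<j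
  beyond-excludes (apex-a ()) a-l
  beyond-excludes (lower-a _ 2+i≤i _) a-l = 1+n≰n (≤-trans (n≤1+n _) 2+i≤i)
  beyond-excludes (lower-c p<p _) c-l = <-irrefl refl p<p
  beyond-excludes (lower-c _ q<q) c-r = <-irrefl refl q<q
  beyond-excludes (wrap-c refl _ (s≤s ()) _) c-l
  beyond-excludes (wrap-c _ q≡cyc _ q≤2n) c-r = cyc≰2n n (subst (_≤ 2 * n) q≡cyc q≤2n)
  beyond-excludes (last-up i≡cyc _ i<2n) a-l = cyc≰2n n (subst (_≤ 2 * n) i≡cyc (<⇒≤ i<2n))
  beyond-excludes (last-21 2≡cyc) a-l = cyc≢ 2 (sym 2≡cyc)

  beyond-sameI : AView n i j₂ → j₁ < j₂ → Beyond n e (a i j₁) → Beyond n e (a i j₂)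
  beyond-sameI _ j₁<j₂ (prime-a j<j₁) = prime-a (<-trans j<j₁ j₁<j₂)
  beyond-sameI _ _ (apex-a 1≤x) = apex-a 1≤x
  beyond-sameI _ _ (lower-a 1≤i 2+i≤x x≤2n) = lower-a 1≤i 2+i≤x x≤2n
  beyond-sameI (apex refl _ _) _ (last-up _ () _)
  beyond-sameI (rim (inj₁ (next _ _ refl))) j₁<j₁ (last-up _ _ _) =
    contradiction j₁<j₁ (<-irrefl refl)
  beyond-sameI (rim (inj₁ (around refl _))) _ (last-up _ (s≤s ()) _)
  beyond-sameI (rim (inj₂ (next _ _ refl))) 2+j₂<j₂ (last-up _ _ _) =
    contradiction 2+j₂<j₂ (<-asym (m<n⇒m<1+n (n<1+n _)))
  beyond-sameI (rim (inj₂ (around refl _))) (s≤s ()) (last-up _ _ _)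
  beyond-sameI (apex () _ _) _ (last-21 _)
  beyond-sameI (rim (inj₁ (next _ _ refl))) _ (last-21 x≡cyc) = last-up x≡cyc ≤-refl (≤2n 3)
  beyond-sameI (rim (inj₁ (around () _))) _ (last-21 _)
  beyond-sameI (rim (inj₂ (next _ _ refl))) (s≤s ()) (last-21 _)
  beyond-sameI (rim (inj₂ (around refl _))) (s≤s ()) (last-21 _)

  beyond-sameJ : AView n i₂ j → i₂ < i₁ → Beyond n e (a i₁ j) → Beyond n e (a i₂ j)
  beyond-sameJ _ _ (prime-a j<j′) = prime-a j<j′
  beyond-sameJ _ () (apex-a _)
  beyond-sameJ (apex refl _ _) _ (lower-a _ 2+i₁≤x _) = apex-a (≤-trans (s≤s z≤n) 2+i₁≤x)
  beyond-sameJ (rim adj) i₂<i₁ (lower-a _ 2+i₁≤x x≤2n) =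
    lower-a (proj₁ (adjacent-bounds adj)) (≤-trans (+-monoʳ-≤ 2 (<⇒≤ i₂<i₁)) 2+i₁≤x) x≤2n
  beyond-sameJ (apex refl _ _) _ (last-up refl _ _) = apex-a (≤cyc 1)
  beyond-sameJ (rim (inj₁ (next _ _ refl))) i₂<i₂ (last-up _ _ _) =
    contradiction i₂<i₂ (<-irrefl refl)
  beyond-sameJ (rim (inj₁ (around _ 1+i₁≡cyc))) _ (last-up _ _ i₁<2n) =
    contradiction (subst (_≤ 2 * n) 1+i₁≡cyc i₁<2n) (cyc≰2n n)
  beyond-sameJ (rim (inj₂ (next _ _ refl))) i₂<i₁ (last-up _ _ _) =
    contradiction i₂<i₁ (<-asym (m<n⇒m<1+n (n<1+n _)))
  beyond-sameJ (rim (inj₂ (around refl _))) _ (last-up _ () _)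
  beyond-sameJ (apex refl _ _) _ (last-21 refl) = apex-a (≤cyc 1)
  beyond-sameJ (rim (inj₁ (next () _ refl))) _ (last-21 _)
  beyond-sameJ (rim (inj₁ (around _ 1≡cyc))) _ (last-21 _) = contradiction (sym 1≡cyc) (cyc≢ 1)
  beyond-sameJ (rim (inj₂ (next _ _ refl))) (s≤s (s≤s ())) (last-21 _)
  beyond-sameJ (rim (inj₂ (around _ refl))) cyc<2 (last-21 _) = contradiction cyc<2 (<⇒≯ (≤cyc 3))

  beyond-ac : EdgeView n p q → EndOf (c p q) (orig i) → Beyond n e (a i j) → Beyond n e (c p q)
  beyond-ac _ _ (prime-a _) = prime-c
  beyond-ac (next () _ _) c-l (apex-a _)
  beyond-ac (around () _) c-l (apex-a _)
  beyond-ac (next _ _ ()) c-r (apex-a _)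
  beyond-ac (around _ 0≡cyc) c-r (apex-a _) = contradiction (sym 0≡cyc) (cyc≢ 0)
  beyond-ac (next _ _ refl) c-l (lower-a _ 2+i≤x _) = edge-below (n<1+n _) 2+i≤x
  beyond-ac (around refl refl) c-l (lower-a _ 3≤x x≤2n) = wrap-c refl refl 3≤x x≤2n
  beyond-ac view c-r (lower-a _ 2+i≤x _) = edge-below (edge-< view) (≤-trans (n≤1+n _) 2+i≤x)
  beyond-ac (next _ _ refl) c-l (last-up refl _ i<2n) = edge-below (n<1+n _) (≤2n⇒<cyc n i<2n)
  beyond-ac (around refl _) c-l (last-up _ (s≤s ()) _)
  beyond-ac view c-r (last-up refl _ i<2n) = edge-below (edge-< view) (≤2n⇒<cyc n (<⇒≤ i<2n))
  beyond-ac (next _ _ refl) c-l (last-21 refl) = edge-below (n<1+n _) (≤cyc 4)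
  beyond-ac (around () _) c-l (last-21 _)
  beyond-ac view c-r (last-21 refl) = edge-below (edge-< view) (≤cyc 3)

  beyond-cc : Rule n (c p q) (c p′ q′) → Beyond n e (c p q) → Beyond n e (c p′ q′)
  beyond-cc _ prime-c = prime-c
  beyond-cc (cc _ _) (lower-c p<x _) = edge-below (n<1+n _) p<x
  beyond-cc cwrap₁ (lower-c 1<x cyc<x) = lower-c 1<x (≤-trans (≤cyc 3) (<⇒≤ cyc<x))
  beyond-cc cwrap₂ (lower-c 2n<x cyc<x) = lower-c (<-trans (≤2n 2) 2n<x) cyc<x
  beyond-cc (cc () _) (wrap-c refl _ _ _)
  beyond-cc cwrap₁ (wrap-c _ _ 3≤x _) = edge-below (n<1+n 1) 3≤x
  beyond-cc cwrap₂ (wrap-c 2n≡1 _ _ _) = contradiction (≤-reflexive 2n≡1) (<⇒≱ (≤2n 2))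

  beyond-closed : IsVertex n w → Arc n u w → Beyond n e u → Beyond n e w
  beyond-closed iw (_ , sameI j₁<j₂) = beyond-sameI (a-view iw) j₁<j₂
  beyond-closed iw (_ , sameJ i₁>i₂) = beyond-sameJ (a-view iw) i₁>i₂
  beyond-closed iw ((_ , orig _ , a-l , c∋i) , ac) = beyond-ac (c-view iw) c∋i
  beyond-closed _ ((_ , prime _ , _ , ()) , ac)
  beyond-closed _ (_ , cc 1≤i i≤2n-1) = beyond-cc (cc 1≤i i≤2n-1)
  beyond-closed _ (_ , cwrap₁) = beyond-cc cwrap₁
  beyond-closed _ (_ , cwrap₂) = beyond-cc cwrap₂

  last-a-beyond : Adjacent n (cyc n) j → Adjacent n i₂ j → i₂ < cyc n →
                      Beyond n (orig (cyc n)) (a i₂ j)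
  last-a-beyond (inj₁ (next _ cyc≤2n _)) _ _ = contradiction cyc≤2n (cyc≰2n n)
  last-a-beyond (inj₁ (around cyc≡1 _)) _ _ = contradiction cyc≡1 (cyc≢ 1)
  last-a-beyond (inj₂ (around refl _)) (inj₁ (next () _ refl)) _
  last-a-beyond (inj₂ (around refl _)) (inj₁ (around _ 1≡cyc)) _ =
    contradiction (sym 1≡cyc) (cyc≢ 1)
  last-a-beyond (inj₂ (around refl _)) (inj₂ (next _ _ refl)) _ = last-21 refl
  last-a-beyond (inj₂ (around refl _)) (inj₂ (around _ refl)) cyc<cyc =
    contradiction cyc<cyc (<-irrefl refl)
  last-a-beyond {i₂ = i₂} (inj₂ (next _ _ cyc≡2+i₂)) (inj₁ (next _ _ refl)) _ =
    last-up refl (≤-trans (n≤1+n 2) (≤-pred (subst (4 ≤_) 2n≡1+i₂ 4≤2n)))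
                 (≤-reflexive (sym 2n≡1+i₂))
    where
    2n≡1+i₂ : 2 * n ≡ suc i₂
    2n≡1+i₂ = suc-injective (trans (sym (cyc≡1+2n n)) cyc≡2+i₂)
  last-a-beyond (inj₂ (next _ _ cyc≡1+j)) (inj₁ (around _ j≡cyc)) _ =
    contradiction (sym (trans cyc≡1+j (cong suc j≡cyc))) 1+n≢n
  last-a-beyond (inj₂ (next _ _ cyc≡1+j)) (inj₂ (next _ _ refl)) 1+j<cyc =
    contradiction 1+j<cyc (<-irrefl (sym cyc≡1+j))
  last-a-beyond (inj₂ (next _ _ cyc≡2)) (inj₂ (around refl _)) _ = contradiction cyc≡2 (cyc≢ 2)

  lower-a-beyond : AView n i₁ j → AView n i₂ j → i₂ < i₁ → Beyond n (orig i₁) (a i₂ j)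
  lower-a-beyond _ (apex refl _ _) 0<i₁ = apex-a 0<i₁
  lower-a-beyond (apex refl _ _) (rim _) ()
  lower-a-beyond {i₁ = i₁} {i₂ = i₂} (rim adj₁) (rim adj₂) i₂<i₁
    with m≤n⇒m<n∨m≡n (proj₂ (adjacent-bounds adj₁))
  ... | inj₁ i₁<cyc = lower-a (proj₁ (adjacent-bounds adj₂)) gap (<cyc⇒≤2n n i₁<cyc)
    where
    gap : 2 + i₂ ≤ i₁
    gap with m≤n⇒m<n∨m≡n i₂<i₁
    ... | inj₁ 1+i₂<i₁ = 1+i₂<i₁
    ... | inj₂ refl = contradiction adj₁ (no-triangle adj₂)
  ... | inj₂ refl = last-a-beyond adj₁ adj₂ i₂<i₁

  arc-from-clique : IsVertex n u → IsVertex n w → Arc n u w → EndOf u e → EndOf w e ⊎ Beyond n e w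
  arc-from-clique _ _ (_ , sameI _) a-l = inj₁ a-l
  arc-from-clique _ _ (_ , sameI j₁<j₂) a-r = inj₂ (prime-a j₁<j₂)
  arc-from-clique iu iw (_ , sameJ i₁>i₂) a-l = inj₂ (lower-a-beyond (a-view iu) (a-view iw) i₁>i₂)
  arc-from-clique _ _ (_ , sameJ _) a-r = inj₁ a-r
  arc-from-clique _ _ ((_ , orig _ , a-l , c∋i) , ac) a-l = inj₁ c∋i
  arc-from-clique _ _ ((_ , prime _ , _ , ()) , ac) a-l
  arc-from-clique _ _ (_ , ac) a-r = inj₂ prime-c
  arc-from-clique _ _ (_ , cc _ _) c-l = inj₁ c-r
  arc-from-clique _ _ (_ , cc _ _) c-r = inj₂ (edge-below (n<1+n _) (n<1+n _))
  arc-from-clique _ _ (_ , cwrap₁) c-l = inj₁ c-l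
  arc-from-clique _ _ (_ , cwrap₁) c-r = inj₂ (edge-below (n<1+n 1) (≤cyc 3))
  arc-from-clique _ _ (_ , cwrap₂) c-l = inj₂ (wrap-c refl refl (≤2n 3) ≤-refl)
  arc-from-clique _ _ (_ , cwrap₂) c-r = inj₁ c-r

lemma4 : (n : ℕ) → 2 ≤ n → ¬ ContainsShortcut n
lemma4 n 2≤n record { v = v ; vert = vert ; inj = inj ; path = path
                    ; short = (_ , e₀ , v₀∋e₀ , vᵣ∋e₀) , _
                    ; i = i ; j = j ; i<j = i<j ; noEdge = noEdge } =
  noEdge ((v[i]≢v[j] , e₀ , in-clique i , in-clique j) , forward)
  where
  _⟶_ : Vtx → Vtx → Set
  x ⟶ y = IsVertex n x × IsVertex n y × Arc n x y

  steps : ∀ k → v (inject₁ k) ⟶ v (Fin.suc k)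
  steps k = vert _ , vert _ , path k

  in-clique : ∀ k → EndOf (v k) e₀
  in-clique = walk-stays _⟶_ v steps
    (λ (iu , iw , arc) → arc-from-clique 2≤n iu iw arc)
    (λ (_ , iw , arc) → beyond-closed 2≤n iw arc)
    (beyond-excludes 2≤n) v₀∋e₀ vᵣ∋e₀

  v[i]≢v[j] : v i ≢ v j
  v[i]≢v[j] v[i]≡v[j] = <-irrefl (cong Fin.toℕ (inj v[i]≡v[j])) i<j

  forward : Rule n (v i) (v j)
  forward with rule-total 2≤n (vert i) (vert j) v[i]≢v[j] (in-clique i) (in-clique j)
  ... | inj₁ i⇒j = i⇒j
  ... | inj₂ j⇒i = contradiction (rank-decreasing 2≤n (vert i) j⇒i) (<-asym rank-descends)
    where
    rank-descends : rank n (v j) < rank n (v i)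
    rank-descends = Star-descends (rank n) (λ (_ , iw , arc) → rank-decreasing 2≤n iw (proj₂ arc))
                                  (walk _⟶_ v steps (<⇒≤ i<j)) v[i]≢v[j]
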